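{- Let $e$ be a bridge in a cubic graph $G$ which admits a $\{K_{1,3},K_3,P_4\}$-decomposition $D$. Then $e$ is the middle edge of a part of $D$ isomorphic to $P_4$.
   Context: All graphs are finite, simple, connected and nontrivial. A graph is cubic if every vertex has degree $3$. A bridge is an edge whose removal disconnects the graph. $K_{1,3}$ is the star with three edges, $K_3$ the triangle, and $P_4$ the path on four vertices (three edges); the middle edge of a $P_4$ is the edge joining its two inner vertices. A $\{K_{1,3},K_3,P_4\}$-decomposition of $G$ is a partition of $E(G)$ into subgraphs (parts) each isomorphic to $K_{1,3}$, $K_3$ or $P_4$. -}

module Defs where

open import Data.Nat using (ℕ; _≥_)
open import Data.Fin using (Fin)
open import Data.Bool using (Bool; true; false)
open import Data.List using (List; length; filterᵇ; allFin; lookup)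
open import Data.Product using (_×_; ∃-syntax; Σ-syntax)
open import Data.Sum using (_⊎_)
open import Relation.Nullary using (¬_)
open import Relation.Binary.PropositionalEquality using (_≡_; _≢_)

record Graph (n : ℕ) : Set where
  field
    adj    : Fin n → Fin n → Bool
    sym    : ∀ u v → adj u v ≡ adj v u
    irrefl : ∀ v → adj v v ≡ false
open Graph public

module _ {n : ℕ} where

  Edge : Graph n → Fin n → Fin n → Set
  Edge G u v = adj G u v ≡ true

  SamePair : Fin n → Fin n → Fin n → Fin n → Set
  SamePair u v a b = (u ≡ a × v ≡ b) ⊎ (u ≡ b × v ≡ a)

  data Reach (E : Fin n → Fin n → Set) : Fin n → Fin n → Set where
    here : ∀ {u} → Reach E u u
    step : ∀ {u v w} → E u v → Reach E v w → Reach E u w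

  Connected : Graph n → Set
  Connected G = ∀ u v → Reach (Edge G) u v

  degree : Graph n → Fin n → ℕ
  degree G v = length (filterᵇ (adj G v) (allFin n))

  Cubic : Graph n → Set
  Cubic G = ∀ v → degree G v ≡ 3

  EdgeWithout : Graph n → Fin n → Fin n → Fin n → Fin n → Set
  EdgeWithout G x y u v = Edge G u v × ¬ SamePair u v x y

  Bridge : Graph n → Fin n → Fin n → Set
  Bridge G x y = Edge G x y × ¬ (∀ u v → Reach (EdgeWithout G x y) u v)

-- A part of a decomposition, given by its vertices:
--   star c a b d     : edges ca, cb, cd           (K_{1,3})
--   triangle a b c   : edges ab, bc, ca           (K_3)
--   path a b c d     : edges ab, bc, cd           (P_4, middle edge bc)
data Part (n : ℕ) : Set where
  star     : Fin n → Fin n → Fin n → Fin n → Part n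
  triangle : Fin n → Fin n → Fin n → Part n
  path     : Fin n → Fin n → Fin n → Fin n → Part n

module _ {n : ℕ} where

  Distinct : Part n → Set
  Distinct (star c a b d) =
    c ≢ a × c ≢ b × c ≢ d × a ≢ b × a ≢ d × b ≢ d
  Distinct (triangle a b c) = a ≢ b × a ≢ c × b ≢ c
  Distinct (path a b c d) =
    a ≢ b × a ≢ c × a ≢ d × b ≢ c × b ≢ d × c ≢ d

  InPart : Part n → Fin n → Fin n → Set
  InPart (star c a b d) u v = SamePair u v c a ⊎ SamePair u v c b ⊎ SamePair u v c d
  InPart (triangle a b c) u v = SamePair u v a b ⊎ SamePair u v b c ⊎ SamePair u v c a
  InPart (path a b c d) u v = SamePair u v a b ⊎ SamePair u v b c ⊎ SamePair u v c d

  record Decomposition (G : Graph n) (D : List (Part n)) : Set where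
    field
      distinct  : ∀ (i : Fin (length D)) → Distinct (lookup D i)
      subgraph  : ∀ (i : Fin (length D)) u v → InPart (lookup D i) u v → Edge G u v
      covers    : ∀ u v → Edge G u v → ∃[ i ] InPart (lookup D i) u v
      unique    : ∀ u v (i j : Fin (length D)) →
                  InPart (lookup D i) u v → InPart (lookup D j) u v → i ≡ j

  MiddleEdgeOfP4 : List (Part n) → Fin n → Fin n → Set
  MiddleEdgeOfP4 D x y =
    ∃[ i ] ∃[ a ] ∃[ b ] ∃[ c ] ∃[ d ]
      (lookup D i ≡ path a b c d × SamePair x y b c)

module Submission where

-- Let S be the set of vertices reachable from y in G − xy. Counting the
-- edge-ends lying in S vertex by vertex gives 3|S|; counting them part by
-- part, a part avoiding xy lies on one side of the cut and contributes 0 or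
-- 6, whereas the part containing xy contributes 1 or 5 unless xy is the
-- middle edge of a P₄ (a triangle cannot contain a bridge at all).
-- Comparing the two counts modulo 3 leaves the middle edge as the only option.

open import Defs
open import Data.Nat using (ℕ; suc; _+_; _*_; _≥_)
open import Data.Nat.Properties using (+-*-semiring; *-distribˡ-+; *-zeroʳ; *-identityʳ; +-identityʳ; +-comm)
open import Data.Nat.Divisibility using (_∣_; _∣?_; ∣-refl; ∣m∣n⇒∣m+n; ∣m+n∣m⇒∣n; ∣n⇒∣m*n; _∣0)
open import Algebra.Properties.Semiring.Sum +-*-semiring
  using (sum; sum-syntax; sum-cong-≗; sum-remove; sum-replicate-zero; ∑-comm; ∑-distrib-+; *-distribˡ-sum)
open import Data.Fin using (Fin; zero; suc; _≟_; punchIn)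
open import Data.Fin.Properties using (punchInᵢ≢i)
open import Data.Bool using (Bool; true; false)
open import Data.List using (List; length; filterᵇ; tabulate; lookup)
open import Data.Product using (_×_; _,_; proj₁; ∃-syntax)
open import Data.Sum as Sum using (_⊎_; inj₁; inj₂)
open import Data.Empty using (⊥-elim)
open import Function using (_∘_)
open import Relation.Nullary using (¬_; Dec; yes; no; does; contradiction)
open import Relation.Nullary.Decidable
  using (_×-dec_; _⊎-dec_; from-yes; from-no; dec-true; dec-false; ¬¬-excluded-middle)
open import Relation.Binary.Definitions using (Symmetric)
open import Relation.Binary.PropositionalEquality
  using (_≡_; _≢_; refl; cong; cong₂; subst; ≢-sym; module ≡-Reasoning)
  renaming (sym to ≡-sym; trans to ≡-trans)

𝟙 : Bool → ℕ
𝟙 true  = 1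
𝟙 false = 0

sum-concentrated : ∀ {m} (f : Fin m → ℕ) i → (∀ j → j ≢ i → f j ≡ 0) → sum f ≡ f i
sum-concentrated {suc m} f i f≡0 = begin
  sum f                                   ≡⟨ sum-remove {i = i} f ⟩
  f i + sum (f ∘ punchIn i)               ≡⟨ cong (f i +_) (sum-cong-≗ (λ j → f≡0 _ (punchInᵢ≢i i j))) ⟩
  f i + sum {m} (λ _ → 0)                 ≡⟨ cong (f i +_) (sum-replicate-zero m) ⟩
  f i + 0                                 ≡⟨ +-identityʳ (f i) ⟩
  f i                                     ∎
  where open ≡-Reasoning

∣-sum : ∀ {d m} (f : Fin m → ℕ) → (∀ i → d ∣ f i) → d ∣ sum f
∣-sum {m = 0}     f d∣f = _ ∣0
∣-sum {m = suc m} f d∣f = ∣m∣n⇒∣m+n (d∣f zero) (∣-sum (f ∘ suc) (d∣f ∘ suc))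

∣-sum⇒∣-term : ∀ {d m} (f : Fin m → ℕ) i → (∀ j → j ≢ i → d ∣ f j) → d ∣ sum f → d ∣ f i
∣-sum⇒∣-term {d} {suc m} f i d∣others d∣sum =
  ∣m+n∣m⇒∣n (subst (d ∣_) (≡-trans (sum-remove {i = i} f) (+-comm (f i) _)) d∣sum)
            (∣-sum _ (λ j → d∣others _ (punchInᵢ≢i i j)))

length-filterᵇ-tabulate : ∀ {A : Set} {m} (p : A → Bool) (f : Fin m → A) →
  length (filterᵇ p (tabulate f)) ≡ ∑[ i < m ] 𝟙 (p (f i))
length-filterᵇ-tabulate {m = 0}     p f = refl
length-filterᵇ-tabulate {m = suc m} p f with p (f zero)
... | true  = cong suc (length-filterᵇ-tabulate p (f ∘ suc))
... | false = length-filterᵇ-tabulate p (f ∘ suc)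

¬¬-∀-Dec : ∀ m (P : Fin m → Set) → ¬ ¬ (∀ i → Dec (P i))
¬¬-∀-Dec 0       P k = k (λ ())
¬¬-∀-Dec (suc m) P k =
  ¬¬-∀-Dec m (P ∘ suc) λ P-suc? →
    ¬¬-excluded-middle λ P0? → k λ { zero → P0? ; (suc i) → P-suc? i }

ends₃ : {A : Set} → (A → ℕ) → (p₁ q₁ p₂ q₂ p₃ q₃ : A) → ℕ
ends₃ g p₁ q₁ p₂ q₂ p₃ q₃ = (g p₁ + g q₁) + (g p₂ + g q₂) + (g p₃ + g q₃)

module _ {n : ℕ} where

  SamePair-swap : ∀ {u v a b : Fin n} → SamePair u v a b → SamePair v u a b
  SamePair-swap (inj₁ (u≡a , v≡b)) = inj₂ (v≡b , u≡a)
  SamePair-swap (inj₂ (u≡b , v≡a)) = inj₁ (v≡a , u≡b)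

  SamePair-flip : ∀ {u v a b : Fin n} → SamePair u v a b → SamePair u v b a
  SamePair-flip (inj₁ eqs) = inj₂ eqs
  SamePair-flip (inj₂ eqs) = inj₁ eqs

  SamePair-sym : ∀ {u v a b : Fin n} → SamePair u v a b → SamePair a b u v
  SamePair-sym (inj₁ (refl , refl)) = inj₁ (refl , refl)
  SamePair-sym (inj₂ (refl , refl)) = inj₂ (refl , refl)

  SamePair-trans : ∀ {u v p q a b : Fin n} → SamePair u v p q → SamePair p q a b → SamePair u v a b
  SamePair-trans (inj₁ (refl , refl)) pq~ab = pq~ab
  SamePair-trans (inj₂ (refl , refl)) pq~ab = SamePair-swap pq~ab

  SamePair? : ∀ (u v a b : Fin n) → Dec (SamePair u v a b)
  SamePair? u v a b = (u ≟ a ×-dec v ≟ b) ⊎-dec (u ≟ b ×-dec v ≟ a)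

  SamePair-≢ : ∀ {v w p q r t : Fin n} → q ≢ r → q ≢ t → SamePair v w p q → ¬ SamePair v w r t
  SamePair-≢ q≢r q≢t vw~pq vw~rt with SamePair-trans (SamePair-sym vw~pq) vw~rt
  ... | inj₁ (_ , q≡t) = q≢t q≡t
  ... | inj₂ (_ , q≡r) = q≢r q≡r

  SamePair-≢′ : ∀ {v w p q r t : Fin n} → p ≢ r → p ≢ t → SamePair v w p q → ¬ SamePair v w r t
  SamePair-≢′ p≢r p≢t = SamePair-≢ p≢r p≢t ∘ SamePair-flip

  δ : Fin n → Fin n → ℕ
  δ v p = 𝟙 (does (v ≟ p))

  δ-diag : ∀ p → δ p p ≡ 1
  δ-diag p = cong 𝟙 (dec-true (p ≟ p) refl)

  δ-offdiag : ∀ {v p} → v ≢ p → δ v p ≡ 0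
  δ-offdiag {v} {p} v≢p = cong 𝟙 (dec-false (v ≟ p) v≢p)

  ∑-*δ : ∀ (g : Fin n → ℕ) p → ∑[ v < n ] (g v * δ v p) ≡ g p
  ∑-*δ g p = begin
    ∑[ v < n ] (g v * δ v p) ≡⟨ sum-concentrated _ p off-p ⟩
    g p * δ p p              ≡⟨ cong (g p *_) (δ-diag p) ⟩
    g p * 1                  ≡⟨ *-identityʳ (g p) ⟩
    g p                      ∎
    where
    open ≡-Reasoning
    off-p : ∀ v → v ≢ p → g v * δ v p ≡ 0
    off-p v v≢p = ≡-trans (cong (g v *_) (δ-offdiag v≢p)) (*-zeroʳ (g v))

  rowWeight : (Fin n → ℕ) → (Fin n → Fin n → ℕ) → ℕ
  rowWeight g M = ∑[ v < n ] (g v * ∑[ w < n ] M v w)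

  rowWeight-+ : ∀ g (M N : Fin n → Fin n → ℕ) →
    rowWeight g (λ v w → M v w + N v w) ≡ rowWeight g M + rowWeight g N
  rowWeight-+ g M N = begin
    rowWeight g (λ v w → M v w + N v w)
      ≡⟨ sum-cong-≗ (λ v → ≡-trans (cong (g v *_) (∑-distrib-+ (M v) (N v))) (*-distribˡ-+ (g v) _ _)) ⟩
    ∑[ v < n ] (g v * ∑[ w < n ] M v w + g v * ∑[ w < n ] N v w)
      ≡⟨ ∑-distrib-+ (λ v → g v * ∑[ w < n ] M v w) (λ v → g v * ∑[ w < n ] N v w) ⟩
    rowWeight g M + rowWeight g N
      ∎
    where open ≡-Reasoning

  edgeAdj : Fin n → Fin n → Fin n → Fin n → ℕ
  edgeAdj p q v w = δ v p * δ w q + δ v q * δ w p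

  rowWeight-edgeAdj : ∀ g p q → rowWeight g (edgeAdj p q) ≡ g p + g q
  rowWeight-edgeAdj g p q =
    ≡-trans (rowWeight-+ g (arc p q) (arc q p)) (cong₂ _+_ (rowWeight-arc p q) (rowWeight-arc q p))
    where
    arc : Fin n → Fin n → Fin n → Fin n → ℕ
    arc p q v w = δ v p * δ w q
    rowWeight-arc : ∀ p q → rowWeight g (arc p q) ≡ g p
    rowWeight-arc p q = ≡-trans (sum-cong-≗ (λ v → cong (g v *_) (∑-*δ (λ _ → δ v p) q))) (∑-*δ g p)

  δ*δ-off : ∀ {v w p q : Fin n} → ¬ (v ≡ p × w ≡ q) → δ v p * δ w q ≡ 0
  δ*δ-off {v} {w} {p} {q} ¬eqs with v ≟ p | w ≟ q
  ... | no _    | _       = refl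
  ... | yes v≡p | yes w≡q = contradiction (v≡p , w≡q) ¬eqs
  ... | yes _   | no _    = refl

  edgeAdj-∉ : ∀ {p q v w : Fin n} → ¬ SamePair v w p q → edgeAdj p q v w ≡ 0
  edgeAdj-∉ ¬vw~pq = cong₂ _+_ (δ*δ-off (¬vw~pq ∘ inj₁)) (δ*δ-off (¬vw~pq ∘ inj₂))

  edgeAdj-∈ : ∀ {p q v w : Fin n} → p ≢ q → SamePair v w p q → edgeAdj p q v w ≡ 1
  edgeAdj-∈ {p} {q} p≢q (inj₁ (refl , refl))
    rewrite δ-diag p | δ-diag q | δ-offdiag p≢q = refl
  edgeAdj-∈ {p} {q} p≢q (inj₂ (refl , refl))
    rewrite δ-diag p | δ-diag q | δ-offdiag p≢q | δ-offdiag (≢-sym p≢q) = refl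

  adj₃ : (p₁ q₁ p₂ q₂ p₃ q₃ : Fin n) → Fin n → Fin n → ℕ
  adj₃ p₁ q₁ p₂ q₂ p₃ q₃ v w = edgeAdj p₁ q₁ v w + edgeAdj p₂ q₂ v w + edgeAdj p₃ q₃ v w

  rowWeight-adj₃ : ∀ g p₁ q₁ p₂ q₂ p₃ q₃ →
    rowWeight g (adj₃ p₁ q₁ p₂ q₂ p₃ q₃) ≡ ends₃ g p₁ q₁ p₂ q₂ p₃ q₃
  rowWeight-adj₃ g p₁ q₁ p₂ q₂ p₃ q₃ = begin
    rowWeight g (adj₃ p₁ q₁ p₂ q₂ p₃ q₃)
      ≡⟨ rowWeight-+ g (λ v w → edgeAdj p₁ q₁ v w + edgeAdj p₂ q₂ v w) (edgeAdj p₃ q₃) ⟩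
    rowWeight g (λ v w → edgeAdj p₁ q₁ v w + edgeAdj p₂ q₂ v w) + rowWeight g (edgeAdj p₃ q₃)
      ≡⟨ cong (_+ rowWeight g (edgeAdj p₃ q₃)) (rowWeight-+ g (edgeAdj p₁ q₁) (edgeAdj p₂ q₂)) ⟩
    rowWeight g (edgeAdj p₁ q₁) + rowWeight g (edgeAdj p₂ q₂) + rowWeight g (edgeAdj p₃ q₃)
      ≡⟨ cong₂ _+_ (cong₂ _+_ (rowWeight-edgeAdj g p₁ q₁) (rowWeight-edgeAdj g p₂ q₂))
                   (rowWeight-edgeAdj g p₃ q₃) ⟩
    ends₃ g p₁ q₁ p₂ q₂ p₃ q₃
      ∎
    where open ≡-Reasoning

  adj₃-∉ : ∀ {p₁ q₁ p₂ q₂ p₃ q₃ v w : Fin n} →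
    ¬ (SamePair v w p₁ q₁ ⊎ SamePair v w p₂ q₂ ⊎ SamePair v w p₃ q₃) →
    adj₃ p₁ q₁ p₂ q₂ p₃ q₃ v w ≡ 0
  adj₃-∉ ∉ = cong₂ _+_ (cong₂ _+_ (edgeAdj-∉ (∉ ∘ inj₁)) (edgeAdj-∉ (∉ ∘ inj₂ ∘ inj₁)))
                       (edgeAdj-∉ (∉ ∘ inj₂ ∘ inj₂))

  adj₃-∈ : ∀ {p₁ q₁ p₂ q₂ p₃ q₃ v w : Fin n} → p₁ ≢ q₁ → p₂ ≢ q₂ → p₃ ≢ q₃ →
    (SamePair v w p₁ q₁ → ¬ SamePair v w p₂ q₂) →
    (SamePair v w p₁ q₁ → ¬ SamePair v w p₃ q₃) →
    (SamePair v w p₂ q₂ → ¬ SamePair v w p₃ q₃) →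
    (SamePair v w p₁ q₁ ⊎ SamePair v w p₂ q₂ ⊎ SamePair v w p₃ q₃) →
    adj₃ p₁ q₁ p₂ q₂ p₃ q₃ v w ≡ 1
  adj₃-∈ p₁≢q₁ _ _ ¬12 ¬13 _ (inj₁ e₁)
    rewrite edgeAdj-∈ p₁≢q₁ e₁ | edgeAdj-∉ (¬12 e₁) | edgeAdj-∉ (¬13 e₁) = refl
  adj₃-∈ _ p₂≢q₂ _ ¬12 _ ¬23 (inj₂ (inj₁ e₂))
    rewrite edgeAdj-∉ (λ e₁ → ¬12 e₁ e₂) | edgeAdj-∈ p₂≢q₂ e₂ | edgeAdj-∉ (¬23 e₂) = refl
  adj₃-∈ _ _ p₃≢q₃ _ ¬13 ¬23 (inj₂ (inj₂ e₃))
    rewrite edgeAdj-∉ (λ e₁ → ¬13 e₁ e₃) | edgeAdj-∉ (λ e₂ → ¬23 e₂ e₃) | edgeAdj-∈ p₃≢q₃ e₃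
    = refl

  partAdj : Part n → Fin n → Fin n → ℕ
  partAdj (star c a b d)   = adj₃ c a c b c d
  partAdj (triangle a b c) = adj₃ a b b c c a
  partAdj (path a b c d)   = adj₃ a b b c c d

  endWeight : (Fin n → ℕ) → Part n → ℕ
  endWeight g (star c a b d)   = ends₃ g c a c b c d
  endWeight g (triangle a b c) = ends₃ g a b b c c a
  endWeight g (path a b c d)   = ends₃ g a b b c c d

  rowWeight-partAdj : ∀ g P → rowWeight g (partAdj P) ≡ endWeight g P
  rowWeight-partAdj g (star c a b d)   = rowWeight-adj₃ g c a c b c d
  rowWeight-partAdj g (triangle a b c) = rowWeight-adj₃ g a b b c c a
  rowWeight-partAdj g (path a b c d)   = rowWeight-adj₃ g a b b c c d

  partAdj-∉ : ∀ P {v w} → ¬ InPart P v w → partAdj P v w ≡ 0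
  partAdj-∉ (star c a b d)   = adj₃-∉
  partAdj-∉ (triangle a b c) = adj₃-∉
  partAdj-∉ (path a b c d)   = adj₃-∉

  partAdj-∈ : ∀ P {v w} → Distinct P → InPart P v w → partAdj P v w ≡ 1
  partAdj-∈ (star c a b d) (c≢a , c≢b , c≢d , a≢b , a≢d , b≢d) =
    adj₃-∈ c≢a c≢b c≢d (SamePair-≢ (≢-sym c≢a) a≢b) (SamePair-≢ (≢-sym c≢a) a≢d)
           (SamePair-≢ (≢-sym c≢b) b≢d)
  partAdj-∈ (triangle a b c) (a≢b , a≢c , b≢c) =
    adj₃-∈ a≢b b≢c (≢-sym a≢c) (SamePair-≢′ a≢b a≢c) (SamePair-≢ b≢c (≢-sym a≢b))
           (SamePair-≢′ b≢c (≢-sym a≢b))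
  partAdj-∈ (path a b c d) (a≢b , a≢c , a≢d , b≢c , b≢d , c≢d) =
    adj₃-∈ a≢b b≢c c≢d (SamePair-≢′ a≢b a≢c) (SamePair-≢′ a≢c a≢d) (SamePair-≢′ b≢c b≢d)

  InPart-resp : ∀ P {u v a b : Fin n} → SamePair u v a b → InPart P a b → InPart P u v
  InPart-resp P {u} {v} {a} {b} uv~ab = map P (SamePair-trans uv~ab)
    where
    map : ∀ P → (∀ {p q} → SamePair a b p q → SamePair u v p q) → InPart P a b → InPart P u v
    map (star _ _ _ _)   f = Sum.map f (Sum.map f f)
    map (triangle _ _ _) f = Sum.map f (Sum.map f f)
    map (path _ _ _ _)   f = Sum.map f (Sum.map f f)

  degree-as-sum : ∀ G v → degree G v ≡ ∑[ w < n ] 𝟙 (adj G v w)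
  degree-as-sum G v = length-filterᵇ-tabulate (adj G v) (λ w → w)

  module _ {G : Graph n} {D : List (Part n)} (decomposition : Decomposition G D) where
    open Decomposition decomposition

    adj-as-sum : ∀ v w → 𝟙 (adj G v w) ≡ ∑[ i < length D ] partAdj (lookup D i) v w
    adj-as-sum v w with adj G v w in vw∈G
    ... | true with covers v w vw∈G
    ...   | i , vw∈i = ≡-sym (begin
      ∑[ j < length D ] partAdj (lookup D j) v w
        ≡⟨ sum-concentrated _ i (λ j j≢i →
             partAdj-∉ (lookup D j) (j≢i ∘ λ vw∈j → unique v w j i vw∈j vw∈i)) ⟩
      partAdj (lookup D i) v w
        ≡⟨ partAdj-∈ (lookup D i) (distinct i) vw∈i ⟩
      1 ∎)
      where open ≡-Reasoning
    adj-as-sum v w | false = ≡-sym (≡-trans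
      (sum-cong-≗ (λ j → partAdj-∉ (lookup D j) λ vw∈j →
        contradiction (≡-trans (≡-sym vw∈G) (subgraph j v w vw∈j)) λ ()))
      (sum-replicate-zero (length D)))

    handshake : ∀ g → ∑[ v < n ] (g v * degree G v) ≡ ∑[ i < length D ] endWeight g (lookup D i)
    handshake g = begin
      ∑[ v < n ] (g v * degree G v)
        ≡⟨ sum-cong-≗ (λ v → cong (g v *_) (degree-as-sum G v)) ⟩
      ∑[ v < n ] (g v * ∑[ w < n ] 𝟙 (adj G v w))
        ≡⟨ sum-cong-≗ (λ v → cong (g v *_)
             (≡-trans (sum-cong-≗ (adj-as-sum v)) (∑-comm (λ w i → M i v w)))) ⟩
      ∑[ v < n ] (g v * ∑[ i < m ] ∑[ w < n ] M i v w)
        ≡⟨ sum-cong-≗ (λ v → *-distribˡ-sum (g v) (λ i → ∑[ w < n ] M i v w)) ⟩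
      ∑[ v < n ] ∑[ i < m ] (g v * ∑[ w < n ] M i v w)
        ≡⟨ ∑-comm (λ v i → g v * ∑[ w < n ] M i v w) ⟩
      ∑[ i < m ] rowWeight g (M i)
        ≡⟨ sum-cong-≗ (λ i → rowWeight-partAdj g (lookup D i)) ⟩
      ∑[ i < m ] endWeight g (lookup D i)
        ∎
      where
      open ≡-Reasoning
      m : ℕ
      m = length D
      M : Fin m → Fin n → Fin n → ℕ
      M i = partAdj (lookup D i)

  module _ {R : Fin n → Fin n → Set} where

    Reach-snoc : ∀ {u v w} → Reach R u v → R v w → Reach R u w
    Reach-snoc here       vw = step vw here
    Reach-snoc (step e r) vw = step e (Reach-snoc r vw)

    Reach-trans : ∀ {u v w} → Reach R u v → Reach R v w → Reach R u w
    Reach-trans here       r′ = r′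
    Reach-trans (step e r) r′ = step e (Reach-trans r r′)

    Reach-sym : Symmetric R → Symmetric (Reach R)
    Reach-sym R-sym here       = here
    Reach-sym R-sym (step e r) = Reach-snoc (Reach-sym R-sym r) (R-sym e)

    Reach-closed : Symmetric R → ∀ {y} (reach? : ∀ v → Dec (Reach R y v)) →
      ∀ {u v} → R u v → does (reach? u) ≡ does (reach? v)
    Reach-closed R-sym reach? {u} {v} uv with reach? u | reach? v
    ... | yes _  | yes _  = refl
    ... | no _   | no _   = refl
    ... | yes yu | no ¬yv = contradiction (Reach-snoc yu uv) ¬yv
    ... | no ¬yu | yes yv = contradiction (Reach-snoc yv (R-sym uv)) ¬yu

  EdgeWithout-sym : ∀ (G : Graph n) x y → Symmetric (EdgeWithout G x y)
  EdgeWithout-sym G x y {u} {v} (uv∈G , ¬uv~xy) =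
    ≡-trans (Graph.sym G v u) uv∈G , ¬uv~xy ∘ SamePair-swap

  bridge-separates : ∀ (G : Graph n) {x y} → Connected G → Bridge G x y →
    ¬ Reach (EdgeWithout G x y) y x
  bridge-separates G {x} {y} connected (_ , disconnected) yx =
    disconnected λ u v → detour (connected u v)
    where
    detour : ∀ {u v} → Reach (Edge G) u v → Reach (EdgeWithout G x y) u v
    detour here = here
    detour (step {u} {w} uw r) with SamePair? u w x y
    ... | yes (inj₁ (refl , refl)) = Reach-trans (Reach-sym (EdgeWithout-sym G x y) yx) (detour r)
    ... | yes (inj₂ (refl , refl)) = Reach-trans yx (detour r)
    ... | no ¬uw~xy                = step (uw , ¬uw~xy) (detour r)

  bridge-sides : ∀ (G : Graph n) {x y : Fin n} → Connected G → Bridge G x y →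
    (reach? : ∀ v → Dec (Reach (EdgeWithout G x y) y v)) → does (reach? x) ≢ does (reach? y)
  bridge-sides G {x} {y} connected bridge reach?
    rewrite dec-false (reach? x) (bridge-separates G connected bridge) | dec-true (reach? y) here = λ ()

  IsMiddleEdge : Part n → Fin n → Fin n → Set
  IsMiddleEdge P x y = ∃[ a ] ∃[ b ] ∃[ c ] ∃[ d ] (P ≡ path a b c d × SamePair x y b c)

  NonMiddleEdge : Part n → Fin n → Fin n → Set
  NonMiddleEdge P@(star _ _ _ _)   x y = InPart P x y
  NonMiddleEdge P@(triangle _ _ _) x y = InPart P x y
  NonMiddleEdge (path a b c d)     x y = SamePair x y a b ⊎ SamePair x y c d

  middle-or-nonMiddle : ∀ P {x y} → InPart P x y → IsMiddleEdge P x y ⊎ NonMiddleEdge P x y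
  middle-or-nonMiddle (star _ _ _ _)   xy∈P                  = inj₂ xy∈P
  middle-or-nonMiddle (triangle _ _ _) xy∈P                  = inj₂ xy∈P
  middle-or-nonMiddle (path a b c d)   (inj₁ xy~ab)          = inj₂ (inj₁ xy~ab)
  middle-or-nonMiddle (path a b c d)   (inj₂ (inj₁ xy~bc))   = inj₁ (a , b , c , d , refl , xy~bc)
  middle-or-nonMiddle (path a b c d)   (inj₂ (inj₂ xy~cd))   = inj₂ (inj₂ xy~cd)

-- The Booleans below are the sides of the cut on which the vertices of a part lie.

3∣ends₃-star : ∀ c a b d → c ≡ a → c ≡ b → c ≡ d → 3 ∣ ends₃ 𝟙 c a c b c d
3∣ends₃-star true  _ _ _ refl refl refl = from-yes (3 ∣? 6)
3∣ends₃-star false _ _ _ refl refl refl = from-yes (3 ∣? 0)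

3∣ends₃-triangle : ∀ a b c → a ≡ b → b ≡ c → 3 ∣ ends₃ 𝟙 a b b c c a
3∣ends₃-triangle true  _ _ refl refl = from-yes (3 ∣? 6)
3∣ends₃-triangle false _ _ refl refl = from-yes (3 ∣? 0)

3∣ends₃-path : ∀ a b c d → a ≡ b → b ≡ c → c ≡ d → 3 ∣ ends₃ 𝟙 a b b c c d
3∣ends₃-path true  _ _ _ refl refl refl = from-yes (3 ∣? 6)
3∣ends₃-path false _ _ _ refl refl refl = from-yes (3 ∣? 0)

¬3∣ends₃-star₁ : ∀ c a b d → c ≢ a → c ≡ b → c ≡ d → ¬ 3 ∣ ends₃ 𝟙 c a c b c d
¬3∣ends₃-star₁ true  true  _ _ c≢a _    _    = contradiction refl c≢a
¬3∣ends₃-star₁ false false _ _ c≢a _    _    = contradiction refl c≢a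
¬3∣ends₃-star₁ true  false _ _ _   refl refl = from-no (3 ∣? 5)
¬3∣ends₃-star₁ false true  _ _ _   refl refl = from-no (3 ∣? 1)

¬3∣ends₃-star₂ : ∀ c a b d → c ≢ b → c ≡ a → c ≡ d → ¬ 3 ∣ ends₃ 𝟙 c a c b c d
¬3∣ends₃-star₂ true  _ true  _ c≢b _    _    = contradiction refl c≢b
¬3∣ends₃-star₂ false _ false _ c≢b _    _    = contradiction refl c≢b
¬3∣ends₃-star₂ true  _ false _ _   refl refl = from-no (3 ∣? 5)
¬3∣ends₃-star₂ false _ true  _ _   refl refl = from-no (3 ∣? 1)

¬3∣ends₃-star₃ : ∀ c a b d → c ≢ d → c ≡ a → c ≡ b → ¬ 3 ∣ ends₃ 𝟙 c a c b c d
¬3∣ends₃-star₃ true  _ _ true  c≢d _    _    = contradiction refl c≢d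
¬3∣ends₃-star₃ false _ _ false c≢d _    _    = contradiction refl c≢d
¬3∣ends₃-star₃ true  _ _ false _   refl refl = from-no (3 ∣? 5)
¬3∣ends₃-star₃ false _ _ true  _   refl refl = from-no (3 ∣? 1)

¬3∣ends₃-path₁ : ∀ a b c d → a ≢ b → b ≡ c → c ≡ d → ¬ 3 ∣ ends₃ 𝟙 a b b c c d
¬3∣ends₃-path₁ true  true  _ _ a≢b _    _    = contradiction refl a≢b
¬3∣ends₃-path₁ false false _ _ a≢b _    _    = contradiction refl a≢b
¬3∣ends₃-path₁ true  false _ _ _   refl refl = from-no (3 ∣? 1)
¬3∣ends₃-path₁ false true  _ _ _   refl refl = from-no (3 ∣? 5)

¬3∣ends₃-path₃ : ∀ a b c d → c ≢ d → a ≡ b → b ≡ c → ¬ 3 ∣ ends₃ 𝟙 a b b c c d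
¬3∣ends₃-path₃ _ _ true  true  c≢d _    _    = contradiction refl c≢d
¬3∣ends₃-path₃ _ _ false false c≢d _    _    = contradiction refl c≢d
¬3∣ends₃-path₃ _ _ true  false _   refl refl = from-no (3 ∣? 5)
¬3∣ends₃-path₃ _ _ false true  _   refl refl = from-no (3 ∣? 1)

pattern edge₁ = inj₁ (inj₁ (refl , refl))
pattern edge₂ = inj₂ (inj₁ (inj₁ (refl , refl)))
pattern edge₃ = inj₂ (inj₂ (inj₁ (refl , refl)))

module _ {n : ℕ} where

  PartOf : Graph n → Part n → Set
  PartOf G P = ∀ u v → InPart P u v → Edge G u v

  module _ (G : Graph n) (x y : Fin n) (s : Fin n → Bool) (xy-crosses : s x ≢ s y)
           (uncut : ∀ {u v} → EdgeWithout G x y u v → s u ≡ s v) where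

    sameSide : ∀ {p q} → Edge G p q → ¬ SamePair x y p q → s p ≡ s q
    sameSide pq∈G ¬xy~pq = uncut (pq∈G , ¬xy~pq ∘ SamePair-sym)

    oppositeSides : ∀ {p q} → SamePair x y p q → s p ≢ s q
    oppositeSides (inj₁ (refl , refl)) = xy-crosses
    oppositeSides (inj₂ (refl , refl)) = xy-crosses ∘ ≡-sym

    3∣endWeight-avoiding : ∀ P → PartOf G P → ¬ InPart P x y → 3 ∣ endWeight (𝟙 ∘ s) P
    3∣endWeight-avoiding P P⊆G xy∉P = by-shape P λ pq∈P →
      sameSide (P⊆G _ _ pq∈P) (xy∉P ∘ λ xy~pq → InPart-resp P xy~pq pq∈P)
      where
      by-shape : ∀ P → (∀ {p q} → InPart P p q → s p ≡ s q) → 3 ∣ endWeight (𝟙 ∘ s) P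
      by-shape (star c a b d) mono =
        3∣ends₃-star (s c) (s a) (s b) (s d) (mono edge₁)
          (mono edge₂) (mono edge₃)
      by-shape (triangle a b c) mono =
        3∣ends₃-triangle (s a) (s b) (s c) (mono edge₁) (mono edge₂)
      by-shape (path a b c d) mono =
        3∣ends₃-path (s a) (s b) (s c) (s d) (mono edge₁)
          (mono edge₂) (mono edge₃)

    ¬3∣endWeight-nonMiddle : ∀ P → Distinct P → PartOf G P → NonMiddleEdge P x y →
      ¬ 3 ∣ endWeight (𝟙 ∘ s) P
    ¬3∣endWeight-nonMiddle (star c a b d) (c≢a , c≢b , c≢d , a≢b , a≢d , b≢d) P⊆G (inj₁ xy~ca) =
      ¬3∣ends₃-star₁ (s c) (s a) (s b) (s d) (oppositeSides xy~ca)
        (sameSide (P⊆G _ _ edge₂) (SamePair-≢ (≢-sym c≢a) a≢b xy~ca))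
        (sameSide (P⊆G _ _ edge₃) (SamePair-≢ (≢-sym c≢a) a≢d xy~ca))
    ¬3∣endWeight-nonMiddle (star c a b d) (c≢a , c≢b , c≢d , a≢b , a≢d , b≢d) P⊆G (inj₂ (inj₁ xy~cb)) =
      ¬3∣ends₃-star₂ (s c) (s a) (s b) (s d) (oppositeSides xy~cb)
        (sameSide (P⊆G _ _ edge₁) (SamePair-≢ (≢-sym c≢b) (≢-sym a≢b) xy~cb))
        (sameSide (P⊆G _ _ edge₃) (SamePair-≢ (≢-sym c≢b) b≢d xy~cb))
    ¬3∣endWeight-nonMiddle (star c a b d) (c≢a , c≢b , c≢d , a≢b , a≢d , b≢d) P⊆G (inj₂ (inj₂ xy~cd)) =
      ¬3∣ends₃-star₃ (s c) (s a) (s b) (s d) (oppositeSides xy~cd)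
        (sameSide (P⊆G _ _ edge₁) (SamePair-≢ (≢-sym c≢d) (≢-sym a≢d) xy~cd))
        (sameSide (P⊆G _ _ edge₂) (SamePair-≢ (≢-sym c≢d) (≢-sym b≢d) xy~cd))
    ¬3∣endWeight-nonMiddle (triangle a b c) (a≢b , a≢c , b≢c) P⊆G (inj₁ xy~ab) _ =
      oppositeSides xy~ab (≡-sym (≡-trans
        (sameSide (P⊆G _ _ edge₂) (SamePair-≢′ a≢b a≢c xy~ab))
        (sameSide (P⊆G _ _ edge₃) (SamePair-≢ b≢c (≢-sym a≢b) xy~ab))))
    ¬3∣endWeight-nonMiddle (triangle a b c) (a≢b , a≢c , b≢c) P⊆G (inj₂ (inj₁ xy~bc)) _ =
      oppositeSides xy~bc (≡-sym (≡-trans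
        (sameSide (P⊆G _ _ edge₃) (SamePair-≢′ b≢c (≢-sym a≢b) xy~bc))
        (sameSide (P⊆G _ _ edge₁) (SamePair-≢ (≢-sym a≢c) (≢-sym b≢c) xy~bc))))
    ¬3∣endWeight-nonMiddle (triangle a b c) (a≢b , a≢c , b≢c) P⊆G (inj₂ (inj₂ xy~ca)) _ =
      oppositeSides xy~ca (≡-sym (≡-trans
        (sameSide (P⊆G _ _ edge₁) (SamePair-≢′ (≢-sym a≢c) (≢-sym b≢c) xy~ca))
        (sameSide (P⊆G _ _ edge₂) (SamePair-≢ a≢b a≢c xy~ca))))
    ¬3∣endWeight-nonMiddle (path a b c d) (a≢b , a≢c , a≢d , b≢c , b≢d , c≢d) P⊆G (inj₁ xy~ab) =
      ¬3∣ends₃-path₁ (s a) (s b) (s c) (s d) (oppositeSides xy~ab)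
        (sameSide (P⊆G _ _ edge₂) (SamePair-≢′ a≢b a≢c xy~ab))
        (sameSide (P⊆G _ _ edge₃) (SamePair-≢′ a≢c a≢d xy~ab))
    ¬3∣endWeight-nonMiddle (path a b c d) (a≢b , a≢c , a≢d , b≢c , b≢d , c≢d) P⊆G (inj₂ xy~cd) =
      ¬3∣ends₃-path₃ (s a) (s b) (s c) (s d) (oppositeSides xy~cd)
        (sameSide (P⊆G _ _ edge₁) (SamePair-≢′ (≢-sym a≢c) (≢-sym b≢c) xy~cd))
        (sameSide (P⊆G _ _ edge₂) (SamePair-≢ (≢-sym b≢d) (≢-sym c≢d) xy~cd))

    cut-edge-nonMiddle-impossible : ∀ {D} → (∀ v → 3 ∣ degree G v) → Decomposition G D →
      ∀ i → InPart (lookup D i) x y → ¬ NonMiddleEdge (lookup D i) x y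
    cut-edge-nonMiddle-impossible {D} 3∣degree decomposition i xy∈i nonMiddle =
      ¬3∣endWeight-nonMiddle (lookup D i) (distinct i) (subgraph i) nonMiddle
        (∣-sum⇒∣-term (λ j → endWeight (𝟙 ∘ s) (lookup D j)) i 3∣others 3∣total)
      where
      open Decomposition decomposition
      3∣total : 3 ∣ ∑[ j < length D ] endWeight (𝟙 ∘ s) (lookup D j)
      3∣total = subst (3 ∣_) (handshake decomposition (𝟙 ∘ s))
                      (∣-sum _ (λ v → ∣n⇒∣m*n (𝟙 (s v)) (3∣degree v)))
      3∣others : ∀ j → j ≢ i → 3 ∣ endWeight (𝟙 ∘ s) (lookup D j)
      3∣others j j≢i = 3∣endWeight-avoiding (lookup D j) (subgraph j)
                         (j≢i ∘ λ xy∈j → unique x y j i xy∈j xy∈i)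

lemma2 : ∀ (n : ℕ) (G : Graph n) → n ≥ 2 → Connected G → Cubic G →
    (D : List (Part n)) → Decomposition G D →
    ∀ (x y : Fin n) → Bridge G x y → MiddleEdgeOfP4 D x y
lemma2 n G _ connected cubic D decomposition x y bridge
  with Decomposition.covers decomposition x y (proj₁ bridge)
... | i , xy∈i with middle-or-nonMiddle (lookup D i) xy∈i
...   | inj₁ middle    = i , middle
...   | inj₂ nonMiddle = ⊥-elim (¬¬-∀-Dec n (Reach (EdgeWithout G x y) y) λ reach? →
  cut-edge-nonMiddle-impossible G x y (does ∘ reach?)
    (bridge-sides G connected bridge reach?) (Reach-closed (EdgeWithout-sym G x y) reach?)
    (λ v → subst (3 ∣_) (≡-sym (cubic v)) ∣-refl) decomposition i xy∈i nonMiddle)
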